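{- Let $k\geq 1$ and $j\ge 0$ be integers and let $F$ be a Boolean polynomial over $\mathbb{F}_2$ in the variables $X_1,\dots,X_j$. Then $$S(\sigma_{n+j,2k}+F)=S(\sigma_{n+1+j,2k+1}+F)\quad\text{for every positive integer } n$$ if and only if $F$ is balanced.
   Context: $\sigma_{N,k}$ is the elementary symmetric polynomial of degree $k$ in $X_1,\dots,X_N$ over $\mathbb{F}_2$ (equal to $0$ if $k>N$); the polynomial $\sigma_{N,k}+F$ is regarded as a polynomial in $X_1,\dots,X_N$ ($N\ge j$). For a Boolean polynomial $G$ in $N$ variables, $S(G)=\sum_{x\in\mathbb{F}_2^N}(-1)^{G(x)}$; $G$ (here $F$, as a function on $\mathbb{F}_2^j$) is balanced if $S(G)=0$. -}

module Defs where

open import Data.Nat using (ℕ; zero; suc; _+_)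
open import Data.Bool using (Bool; true; false; _xor_; _∧_; if_then_else_)
open import Data.Vec using (Vec; []; _∷_; take; drop)
open import Data.List using (List; []; _∷_; map; _++_; foldr)
open import Data.Integer using (ℤ; +_; -_) renaming (_+_ to _+ℤ_)
open import Data.Fin.Subset using (Subset; ∣_∣; _∈_)
open import Relation.Binary.PropositionalEquality using (_≡_)
open import Data.Nat using (_≟_)
open import Relation.Nullary.Decidable using (⌊_⌋)

-- All points of 𝔽₂ⁿ (Bool = 𝔽₂), also used as all subsets of Fin n.
allPoints : (n : ℕ) → List (Vec Bool n)
allPoints zero = [] ∷ []
allPoints (suc n) = map (false ∷_) (allPoints n) ++ map (true ∷_) (allPoints n)

monomial : {n : ℕ} → Subset n → Vec Bool n → Bool
monomial [] [] = true
monomial (false ∷ m) (_ ∷ x) = monomial m x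
monomial (true ∷ m) (b ∷ x) = b ∧ monomial m x

-- A Boolean polynomial over 𝔽₂ in n variables, in algebraic normal form:
-- the coefficient (in 𝔽₂) of each squarefree monomial, indexed by its
-- set of variables.
BoolPoly : ℕ → Set
BoolPoly n = Subset n → Bool

eval : {n : ℕ} → BoolPoly n → Vec Bool n → Bool
eval {n} P x = foldr _xor_ false (map (λ m → P m ∧ monomial m x) (allPoints n))

σ : (N k : ℕ) → BoolPoly N
σ N k m = ⌊ ∣ m ∣ ≟ k ⌋

_⊕_ : {n : ℕ} → BoolPoly n → BoolPoly n → BoolPoly n
(P ⊕ Q) m = P m xor Q m

-- Regard a polynomial in X₁..X_j as a polynomial in X₁..X_{j+n}
-- (monomials involving X_{j+1},…,X_{j+n} get coefficient 0).
-- Vectors are indexed so that the first j entries are X₁..X_j.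
noExtra : {n : ℕ} → Subset n → Bool
noExtra [] = true
noExtra (false ∷ m) = noExtra m
noExtra (true ∷ m) = false

lift : {j : ℕ} (n : ℕ) → BoolPoly j → BoolPoly (j + n)
lift {j} n F m = F (take j m) ∧ noExtra (drop j m)

sign : Bool → ℤ
sign false = + 1
sign true = - (+ 1)

S : {N : ℕ} → BoolPoly N → ℤ
S {N} G = foldr _+ℤ_ (+ 0) (map (λ x → sign (eval G x)) (allPoints N))

Balanced : {j : ℕ} → BoolPoly j → Set
Balanced F = S F ≡ + 0

-- At x ∈ 𝔽₂ᴺ we have σ_{N,d}(x) = C(|x|, d) mod 2, and the lifted F only sees the first j
-- coordinates.  For even d, Lucas gives C(w, d+1) ≡ w·C(w, d) (mod 2), so on two points of
-- 𝔽₂^{j+m+1} differing only in X_{j+1}, of weights w and w+1, σ_{j+m+1,d+1} takes the values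
-- {0, C(w, d)} mod 2.  Summing (-1)^{σ+F} over such pairs gives
--   S(σ_{j+m+1,d+1} + F) = 2ᵐ S(F) + S(σ_{j+m,d} + F),
-- so the two sides of the theorem agree for every n iff S(F) = 0.

module Submission where

open import Defs
open import Data.Nat using (ℕ; zero; suc; _+_; _*_; _≟_)
open import Data.Nat.Properties using (suc-injective; +-suc)
open import Data.Bool using (Bool; true; false; _xor_; _∧_; not)
open import Data.Bool.Properties
  using (∧-zeroʳ; ∧-identityʳ; ∧-distribʳ-xor; xor-identityʳ; xor-∧-commutativeRing)
open import Data.Vec using (Vec; []; _∷_; _++_)
open import Data.List using (List; map; foldr) renaming ([] to []ᴸ; _∷_ to _∷ᴸ_; _++_ to _++ᴸ_)
open import Data.List.Properties using (map-++; map-∘)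
open import Data.Integer using (ℤ; +_; -[1+_]) renaming (_+_ to _+ℤ_)
import Data.Integer.Properties as ℤP
open import Data.Fin.Subset using (∣_∣)
open import Algebra.Bundles using (CommutativeMonoid; CommutativeRing; AbelianGroup)
open import Relation.Binary.PropositionalEquality as ≡ using (_≡_)
open import Algebra.Properties.Group (AbelianGroup.group ℤP.+-0-abelianGroup) using (∙-cancelʳ)
open import Relation.Nullary.Decidable using (⌊_⌋; isYes≗does; does-⇔)
open import Function.Base using (_∘_)
open import Function.Bundles using (_⇔_; mk⇔)

module CubeSum {c ℓ} (M : CommutativeMonoid c ℓ) where

  open CommutativeMonoid M
  open import Algebra.Properties.CommutativeSemigroup commutativeSemigroup using (interchange)
  open import Relation.Binary.Reasoning.Setoid setoid

  ∑ : (n : ℕ) → (Vec Bool n → Carrier) → Carrier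
  ∑ zero    g = g []
  ∑ (suc n) g = ∑ n (λ x → g (false ∷ x)) ∙ ∑ n (λ x → g (true ∷ x))

  private
    sumList : List Carrier → Carrier
    sumList = foldr _∙_ ε

    sumList-++ : ∀ xs ys → sumList (xs ++ᴸ ys) ≈ sumList xs ∙ sumList ys
    sumList-++ []ᴸ       ys = sym (identityˡ _)
    sumList-++ (x ∷ᴸ xs) ys = trans (∙-congˡ (sumList-++ xs ys)) (sym (assoc _ _ _))

  sumList-allPoints : ∀ n (g : Vec Bool n → Carrier) → foldr _∙_ ε (map g (allPoints n)) ≈ ∑ n g
  sumList-allPoints zero    g = identityʳ (g [])
  sumList-allPoints (suc n) g = begin
    sumList (map g (map (false ∷_) xs ++ᴸ map (true ∷_) xs))
      ≈⟨ reflexive (≡.cong sumList (map-++ g (map (false ∷_) xs) (map (true ∷_) xs))) ⟩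
    sumList (map g (map (false ∷_) xs) ++ᴸ map g (map (true ∷_) xs))
      ≈⟨ sumList-++ (map g (map (false ∷_) xs)) (map g (map (true ∷_) xs)) ⟩
    sumList (map g (map (false ∷_) xs)) ∙ sumList (map g (map (true ∷_) xs))
      ≈⟨ ∙-cong (reflexive (≡.cong sumList (≡.sym (map-∘ xs))))
                (reflexive (≡.cong sumList (≡.sym (map-∘ xs)))) ⟩
    sumList (map (g ∘ (false ∷_)) xs) ∙ sumList (map (g ∘ (true ∷_)) xs)
      ≈⟨ ∙-cong (sumList-allPoints n _) (sumList-allPoints n _) ⟩
    ∑ (suc n) g ∎
    where xs = allPoints n

  ∑-cong : ∀ n {f g : Vec Bool n → Carrier} → (∀ x → f x ≈ g x) → ∑ n f ≈ ∑ n g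
  ∑-cong zero    f≈g = f≈g []
  ∑-cong (suc n) f≈g = ∙-cong (∑-cong n (λ x → f≈g (false ∷ x))) (∑-cong n (λ x → f≈g (true ∷ x)))

  ∑-∙ : ∀ n (f g : Vec Bool n → Carrier) → ∑ n (λ x → f x ∙ g x) ≈ ∑ n f ∙ ∑ n g
  ∑-∙ zero    f g = refl
  ∑-∙ (suc n) f g = trans (∙-cong (∑-∙ n _ _) (∑-∙ n _ _)) (interchange _ _ _ _)

  ∑-ε : ∀ n {g : Vec Bool n → Carrier} → (∀ x → g x ≈ ε) → ∑ n g ≈ ε
  ∑-ε zero    g≈ε = g≈ε []
  ∑-ε (suc n) g≈ε =
    trans (∙-cong (∑-ε n (λ x → g≈ε (false ∷ x))) (∑-ε n (λ x → g≈ε (true ∷ x)))) (identityˡ ε)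

  ∑-++ : ∀ j m (g : Vec Bool (j + m) → Carrier) → ∑ (j + m) g ≈ ∑ j (λ y → ∑ m (λ z → g (y ++ z)))
  ∑-++ zero    m g = refl
  ∑-++ (suc j) m g = ∙-cong (∑-++ j m _) (∑-++ j m _)

  ∑-comm : ∀ j m (h : Vec Bool j → Vec Bool m → Carrier) →
           ∑ j (λ y → ∑ m (h y)) ≈ ∑ m (λ z → ∑ j (λ y → h y z))
  ∑-comm zero    m h = refl
  ∑-comm (suc j) m h =
    trans (∙-cong (∑-comm j m _) (∑-comm j m _)) (sym (∑-∙ m _ _))

module Sum𝔽₂ = CubeSum (CommutativeRing.+-commutativeMonoid xor-∧-commutativeRing)
open CubeSum ℤP.+-0-commutativeMonoid
open ≡ using (refl; sym; trans; cong; cong₂; module ≡-Reasoning)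

eval≡∑ : ∀ {n} (P : BoolPoly n) x → eval P x ≡ Sum𝔽₂.∑ n (λ m → P m ∧ monomial m x)
eval≡∑ {n} P x = Sum𝔽₂.sumList-allPoints n _

eval-[] : (P : BoolPoly 0) → eval P [] ≡ P []
eval-[] P = trans (xor-identityʳ _) (∧-identityʳ _)

eval-cong : ∀ {n} {P Q : BoolPoly n} x → (∀ m → P m ≡ Q m) → eval P x ≡ eval Q x
eval-cong {n} {P} {Q} x P≡Q = begin
  eval P x                                ≡⟨ eval≡∑ P x ⟩
  Sum𝔽₂.∑ n (λ m → P m ∧ monomial m x)    ≡⟨ Sum𝔽₂.∑-cong n (λ m → cong (_∧ monomial m x) (P≡Q m)) ⟩
  Sum𝔽₂.∑ n (λ m → Q m ∧ monomial m x)    ≡⟨ sym (eval≡∑ Q x) ⟩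
  eval Q x                                ∎
  where open ≡-Reasoning

eval-zero : ∀ {n} {P : BoolPoly n} x → (∀ m → P m ≡ false) → eval P x ≡ false
eval-zero {n} {P} x P≡0 =
  trans (eval≡∑ P x) (Sum𝔽₂.∑-ε n (λ m → cong (_∧ monomial m x) (P≡0 m)))

eval-⊕ : ∀ {n} (P Q : BoolPoly n) x → eval (P ⊕ Q) x ≡ eval P x xor eval Q x
eval-⊕ {n} P Q x = begin
  eval (P ⊕ Q) x
    ≡⟨ eval≡∑ (P ⊕ Q) x ⟩
  Sum𝔽₂.∑ n (λ m → (P m xor Q m) ∧ monomial m x)
    ≡⟨ Sum𝔽₂.∑-cong n (λ m → ∧-distribʳ-xor (monomial m x) (P m) (Q m)) ⟩
  Sum𝔽₂.∑ n (λ m → (P m ∧ monomial m x) xor (Q m ∧ monomial m x))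
    ≡⟨ Sum𝔽₂.∑-∙ n _ _ ⟩
  Sum𝔽₂.∑ n (λ m → P m ∧ monomial m x) xor Sum𝔽₂.∑ n (λ m → Q m ∧ monomial m x)
    ≡⟨ sym (cong₂ _xor_ (eval≡∑ P x) (eval≡∑ Q x)) ⟩
  eval P x xor eval Q x ∎
  where open ≡-Reasoning

eval-∷ : ∀ {n} (P : BoolPoly (suc n)) b x →
         eval P (b ∷ x) ≡ eval (λ m → P (false ∷ m)) x xor (b ∧ eval (λ m → P (true ∷ m)) x)
eval-∷ P true x =
  trans (eval≡∑ P (true ∷ x)) (sym (cong₂ _xor_ (eval≡∑ _ x) (eval≡∑ _ x)))
eval-∷ {n} P false x =
  trans (eval≡∑ P (false ∷ x))
        (cong₂ _xor_ (sym (eval≡∑ _ x)) (Sum𝔽₂.∑-ε n (λ m → ∧-zeroʳ (P (true ∷ m)))))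

binomialOdd : ℕ → ℕ → Bool
binomialOdd w       zero    = true
binomialOdd zero    (suc d) = false
binomialOdd (suc w) (suc d) = binomialOdd w (suc d) xor binomialOdd w d

≟-suc : ∀ m n → ⌊ suc m ≟ suc n ⌋ ≡ ⌊ m ≟ n ⌋
≟-suc m n = trans (isYes≗does (suc m ≟ suc n))
  (trans (does-⇔ (mk⇔ suc-injective (cong suc)) (suc m ≟ suc n) (m ≟ n)) (sym (isYes≗does (m ≟ n))))

eval-σ : ∀ N d (x : Vec Bool N) → eval (σ N d) x ≡ binomialOdd ∣ x ∣ d
eval-σ zero    zero    []          = refl
eval-σ zero    (suc d) []          = refl
eval-σ (suc N) d       (false ∷ x) =
  trans (eval-∷ (σ (suc N) d) false x) (trans (xor-identityʳ _) (eval-σ N d x))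
eval-σ (suc N) zero    (true ∷ x)  =
  trans (eval-∷ (σ (suc N) zero) true x) (cong₂ _xor_ (eval-σ N zero x) (eval-zero x (λ m → refl)))
eval-σ (suc N) (suc d) (true ∷ x)  =
  trans (eval-∷ (σ (suc N) (suc d)) true x)
        (cong₂ _xor_ (eval-σ N (suc d) x)
                     (trans (eval-cong x (λ m → ≟-suc ∣ m ∣ d)) (eval-σ N d x)))

eval-constant : ∀ {n} b (x : Vec Bool n) → eval (λ m → b ∧ noExtra m) x ≡ b
eval-constant b []      = trans (eval-[] (λ m → b ∧ noExtra m)) (∧-identityʳ b)
eval-constant b (a ∷ x) = begin
  eval (λ m → b ∧ noExtra m) (a ∷ x)
    ≡⟨ eval-∷ (λ m → b ∧ noExtra m) a x ⟩
  eval (λ m → b ∧ noExtra m) x xor (a ∧ eval (λ _ → b ∧ false) x)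
    ≡⟨ cong₂ _xor_ (eval-constant b x) (cong (a ∧_) (eval-zero x (λ _ → ∧-zeroʳ b))) ⟩
  b xor (a ∧ false)
    ≡⟨ cong (b xor_) (∧-zeroʳ a) ⟩
  b xor false
    ≡⟨ xor-identityʳ b ⟩
  b ∎
  where open ≡-Reasoning

eval-lift : ∀ {j} m (F : BoolPoly j) y (z : Vec Bool m) → eval (lift m F) (y ++ z) ≡ eval F y
eval-lift m F []      z = trans (eval-constant (F []) z) (sym (eval-[] F))
eval-lift m F (b ∷ y) z =
  trans (eval-∷ (lift m F) b (y ++ z))
        (trans (cong₂ (λ u v → u xor (b ∧ v)) (eval-lift m _ y z) (eval-lift m _ y z))
               (sym (eval-∷ F b y)))

eval-σ⊕lift : ∀ {j} m d (F : BoolPoly j) y (z : Vec Bool m) →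
              eval (σ (j + m) d ⊕ lift m F) (y ++ z) ≡ binomialOdd ∣ y ++ z ∣ d xor eval F y
eval-σ⊕lift {j} m d F y z =
  trans (eval-⊕ (σ (j + m) d) (lift m F) (y ++ z))
        (cong₂ _xor_ (eval-σ (j + m) d (y ++ z)) (eval-lift m F y z))

odd : ℕ → Bool
odd zero    = false
odd (suc w) = not (odd w)

double : ℕ → ℕ
double zero    = zero
double (suc k) = suc (suc (double k))

double≡2* : ∀ k → double k ≡ 2 * k
double≡2* zero    = refl
double≡2* (suc k) = cong suc (trans (cong suc (double≡2* k)) (sym (+-suc k (k + 0))))

∧-xor-absorb : ∀ a b p → (a ∧ p) xor a ≡ (a xor (b ∧ p)) ∧ not p
∧-xor-absorb true  true  true  = refl
∧-xor-absorb true  true  false = refl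
∧-xor-absorb true  false true  = refl
∧-xor-absorb true  false false = refl
∧-xor-absorb false true  true  = refl
∧-xor-absorb false true  false = refl
∧-xor-absorb false false true  = refl
∧-xor-absorb false false false = refl

binomialOdd-suc-double : ∀ w k → binomialOdd w (suc (double k)) ≡ binomialOdd w (double k) ∧ odd w
binomialOdd-suc-double zero    k       = sym (∧-zeroʳ _)
binomialOdd-suc-double (suc w) zero    =
  trans (cong (_xor true) (binomialOdd-suc-double w zero)) (∧-xor-absorb true false (odd w))
binomialOdd-suc-double (suc w) (suc k) = begin
  binomialOdd w (suc (double (suc k))) xor c₂
    ≡⟨ cong (_xor c₂) (binomialOdd-suc-double w (suc k)) ⟩
  (c₂ ∧ odd w) xor c₂
    ≡⟨ ∧-xor-absorb c₂ (binomialOdd w (double k)) (odd w) ⟩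
  (c₂ xor (binomialOdd w (double k) ∧ odd w)) ∧ not (odd w)
    ≡⟨ cong (λ t → (c₂ xor t) ∧ not (odd w)) (sym (binomialOdd-suc-double w k)) ⟩
  (c₂ xor binomialOdd w (suc (double k))) ∧ not (odd w) ∎
  where
  open ≡-Reasoning
  c₂ = binomialOdd w (double (suc k))

binomialOdd-suc-2* : ∀ w k → binomialOdd w (suc (2 * k)) ≡ binomialOdd w (2 * k) ∧ odd w
binomialOdd-suc-2* w k rewrite sym (double≡2* k) = binomialOdd-suc-double w k

∣++∷∣ : ∀ {a b} (y : Vec Bool a) t (z : Vec Bool b) → ∣ y ++ t ∷ z ∣ ≡ ∣ t ∷ y ++ z ∣
∣++∷∣ []          t     z = refl
∣++∷∣ (false ∷ y) t     z = ∣++∷∣ y t z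
∣++∷∣ (true ∷ y)  false z = cong suc (∣++∷∣ y false z)
∣++∷∣ (true ∷ y)  true  z = cong suc (∣++∷∣ y true z)

-- {a ∧ p, (a ∧ p) xor a} = {false, a} as multisets.
sign-pair : ∀ a p g → sign ((a ∧ p) xor g) +ℤ sign (((a ∧ p) xor a) xor g) ≡ sign g +ℤ sign (a xor g)
sign-pair false p     g     = refl
sign-pair true  false g     = refl
sign-pair true  true  false = refl
sign-pair true  true  true  = refl

sign-binomialOdd-pair : ∀ w k g →
  sign (binomialOdd w (suc (2 * k)) xor g) +ℤ sign (binomialOdd (suc w) (suc (2 * k)) xor g)
    ≡ sign g +ℤ sign (binomialOdd w (2 * k) xor g)
sign-binomialOdd-pair w k g rewrite binomialOdd-suc-2* w k =
  sign-pair (binomialOdd w (2 * k)) (odd w) g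

S≡∑ : ∀ {n} (G : BoolPoly n) → S G ≡ ∑ n (λ x → sign (eval G x))
S≡∑ {n} G = sumList-allPoints n _

S-σ⊕lift : ∀ {j} m d (F : BoolPoly j) →
  S (σ (j + m) d ⊕ lift m F) ≡ ∑ j (λ y → ∑ m (λ z → sign (binomialOdd ∣ y ++ z ∣ d xor eval F y)))
S-σ⊕lift {j} m d F =
  trans (S≡∑ (σ (j + m) d ⊕ lift m F)) (trans (∑-++ j m _)
    (∑-cong j (λ y → ∑-cong m (λ z → cong sign (eval-σ⊕lift m d F y z)))))

S-σ⊕lift-odd : ∀ {j} m k (F : BoolPoly j) →
  S (σ (j + suc m) (suc (2 * k)) ⊕ lift (suc m) F)
    ≡ ∑ m (λ _ → S F) +ℤ S (σ (j + m) (2 * k) ⊕ lift m F)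
S-σ⊕lift-odd {j} m k F = begin
  S (σ (j + suc m) (suc (2 * k)) ⊕ lift (suc m) F)
    ≡⟨ S-σ⊕lift (suc m) _ F ⟩
  ∑ j (λ y → ∑ (suc m) (λ z → term (suc (2 * k)) y z))
    ≡⟨ ∑-cong j (λ y → sym (∑-∙ m _ _)) ⟩
  ∑ j (λ y → ∑ m (λ z → term (suc (2 * k)) y (false ∷ z) +ℤ term (suc (2 * k)) y (true ∷ z)))
    ≡⟨ ∑-cong j (λ y → ∑-cong m (λ z → flip-pair y z)) ⟩
  ∑ j (λ y → ∑ m (λ z → sign (eval F y) +ℤ term (2 * k) y z))
    ≡⟨ ∑-cong j (λ y → ∑-∙ m _ _) ⟩
  ∑ j (λ y → ∑ m (λ _ → sign (eval F y)) +ℤ ∑ m (term (2 * k) y))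
    ≡⟨ ∑-∙ j _ _ ⟩
  ∑ j (λ y → ∑ m (λ _ → sign (eval F y))) +ℤ ∑ j (λ y → ∑ m (term (2 * k) y))
    ≡⟨ cong₂ _+ℤ_ (trans (∑-comm j m _) (∑-cong m (λ _ → sym (S≡∑ F)))) (sym (S-σ⊕lift m _ F)) ⟩
  ∑ m (λ _ → S F) +ℤ S (σ (j + m) (2 * k) ⊕ lift m F) ∎
  where
  open ≡-Reasoning
  term : ∀ {l} → ℕ → Vec Bool j → Vec Bool l → ℤ
  term d y z = sign (binomialOdd ∣ y ++ z ∣ d xor eval F y)
  flip-pair : ∀ y z → term (suc (2 * k)) y (false ∷ z) +ℤ term (suc (2 * k)) y (true ∷ z)
                        ≡ sign (eval F y) +ℤ term (2 * k) y z
  flip-pair y z =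
    trans (cong₂ _+ℤ_ (cong (λ w → sign (binomialOdd w (suc (2 * k)) xor eval F y)) (∣++∷∣ y false z))
                      (cong (λ w → sign (binomialOdd w (suc (2 * k)) xor eval F y)) (∣++∷∣ y true z)))
          (sign-binomialOdd-pair ∣ y ++ z ∣ k (eval F y))

x+x≡0⇒x≡0 : ∀ x → x +ℤ x ≡ + 0 → x ≡ + 0
x+x≡0⇒x≡0 (+ zero)  _ = refl
x+x≡0⇒x≡0 (+ suc n) ()
x+x≡0⇒x≡0 -[1+ n ]  ()

theorem3p5 : (k j : ℕ) → (F : BoolPoly j) →
    ((n : ℕ) → S (σ (j + suc n) (2 * suc k) ⊕ lift (suc n) F)
    ≡ S (σ (j + suc (suc n)) (suc (2 * suc k)) ⊕ lift (suc (suc n)) F))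
    ⇔ Balanced F
theorem3p5 k j F = mk⇔ balanced recurrence
  where
  open ≡-Reasoning

  evenS oddS : ℕ → ℤ
  evenS n = S (σ (j + suc n) (2 * suc k) ⊕ lift (suc n) F)
  oddS  n = S (σ (j + suc (suc n)) (suc (2 * suc k)) ⊕ lift (suc (suc n)) F)

  step : ∀ n → oddS n ≡ ∑ (suc n) (λ _ → S F) +ℤ evenS n
  step n = S-σ⊕lift-odd (suc n) (suc k) F

  balanced : (∀ n → evenS n ≡ oddS n) → Balanced F
  balanced evenS≡oddS = x+x≡0⇒x≡0 (S F) (∙-cancelʳ (evenS 0) _ _ (begin
    (S F +ℤ S F) +ℤ evenS 0  ≡⟨ step 0 ⟨
    oddS 0                   ≡⟨ evenS≡oddS 0 ⟨
    evenS 0                  ≡⟨ ℤP.+-identityˡ (evenS 0) ⟨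
    + 0 +ℤ evenS 0           ∎))

  recurrence : Balanced F → ∀ n → evenS n ≡ oddS n
  recurrence SF≡0 n = sym (begin
    oddS n                            ≡⟨ step n ⟩
    ∑ (suc n) (λ _ → S F) +ℤ evenS n  ≡⟨ cong (_+ℤ evenS n) (∑-ε (suc n) (λ _ → SF≡0)) ⟩
    + 0 +ℤ evenS n                    ≡⟨ ℤP.+-identityˡ (evenS n) ⟩
    evenS n                           ∎)
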